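{- Let $S \subseteq \mathbb{Z}$ be a finite nonempty set and let $A_\infty$ be the set produced by the greedy packing algorithm for $S$. Then there exist integers $a, b$ with $0 \le a < b$ such that $A_\infty$ is $a$-forward periodic with period $b - a$.
   Context: For sets $X, Y \subseteq \mathbb{Z}$, $X + Y = \{x + y : x \in X, y \in Y\}$. The difference set of $S$ is $\mathrm{diff}(S) = \{s - t : s, t \in S,\ s \ge t\}$. The greedy packing algorithm for $S$: set $A_{ -1} = \emptyset$, and for each $i \ge 0$ let $t_i = \min\{x \in \mathbb{Z} : x \ge 0,\ x \notin A_{i-1} + \mathrm{diff}(S)\}$ and $A_i = A_{i-1} \cup \{t_i\}$; then $A_\infty = \bigcup_{i \ge 0} A_i$. For $a \in \mathbb{Z}$ and a positive integer $p$, a set $X \subseteq \mathbb{Z}$ is $a$-forward periodic with period $p$ if for all integers $i \ge 0$, $a + i \in X \iff a + i + p \in X$. -}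

module Defs where

open import Data.Nat using (ℕ; zero; suc)
open import Data.Integer using (ℤ; +_; _+_; _-_; _≤_; _≤?_)
import Data.Integer.Properties as ℤP
open import Data.List using (List; []; _∷_; [_]; _++_; map; concatMap; length)
open import Data.List.Membership.DecPropositional ℤP._≟_ using (_∈_; _∈?_)
open import Data.Product using (∃; _×_)
open import Function.Bundles using (_⇔_)
open import Relation.Nullary using (yes; no)

-- Finite sets of integers are represented by lists (duplicates/order irrelevant).

sumset : List ℤ → List ℤ → List ℤ
sumset X Y = concatMap (λ x → map (λ y → x + y) Y) X

diffSet : List ℤ → List ℤ
diffSet S = concatMap (λ s → concatMap (λ t → keep t s) S) S
  where
  keep : ℤ → ℤ → List ℤ
  keep t s with t ≤? s
  ... | yes _ = [ s - t ]
  ... | no  _ = []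

search : ℕ → ℕ → List ℤ → ℕ
search n zero L = n
search n (suc fuel) L with (+ n) ∈? L
... | yes _ = search (suc n) fuel L
... | no  _ = n

-- Among 0, 1, …, length L at least one is absent from L, so fuel length L + 1
-- suffices and the scan from 0 returns exactly the minimum.
leastAbsent : List ℤ → ℕ
leastAbsent L = search 0 (suc (length L)) L

-- Aprev S i = A_{i-1}  (so Aprev S 0 = A_{-1} = ∅),
-- t S i     = t_i = min { x ≥ 0 : x ∉ A_{i-1} + diff(S) },
-- A_i       = A_{i-1} ∪ { t_i }  = Aprev S (suc i).
mutual
  Aprev : List ℤ → ℕ → List ℤ
  Aprev S zero    = []
  Aprev S (suc i) = Aprev S i ++ [ + t S i ]

  t : List ℤ → ℕ → ℕ
  t S i = leastAbsent (sumset (Aprev S i) (diffSet S))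

A : List ℤ → ℕ → List ℤ
A S i = Aprev S (suc i)

A∞ : List ℤ → ℤ → Set
A∞ S x = ∃ λ i → x ∈ A S i

ForwardPeriodic : (ℤ → Set) → ℤ → ℤ → Set
ForwardPeriodic X a p = ∀ (i : ℕ) → X (a + + i) ⇔ X (a + + i + p)

{-# OPTIONS --safe #-}
-- Write A∞ = {t₀ < t₁ < …}. The greedy choice turns membership into a rule of bounded
-- memory: n ∈ A∞ iff n − d ∉ A∞ for every positive d ∈ diff(S) with d ≤ n. Indeed, if
-- tᵢ − d = tⱼ then tᵢ = tⱼ + d ∈ A_{i−1} + diff(S), which the greedy choice forbids;
-- conversely n < t_{n+1} writes n = tⱼ + e with e ∈ diff(S), and e = 0 makes n a term.
-- So whether n ∈ A∞ depends only on the window of the M = max diff(S) positions below n.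
-- There are at most 2^M windows, so two positions a < b share one, and the rule then
-- propagates the agreement to a + k and b + k for every k.
module Submission where

open import Defs
open import Data.Bool.Base using (Bool)
open import Data.Empty using (⊥-elim)
open import Data.Fin.Base using (Fin; toℕ; fromℕ<; funToFin; finToFun)
open import Data.Fin.Properties
  using (pigeonhole; <⇒notInjective; toℕ-injective; toℕ≤pred[n]; toℕ-fromℕ<; finToFun-funToFin; 2↔Bool)
open import Data.Integer.Base as ℤ using (ℤ; +_; _-_; _≤_; _<_; +≤+; +<+)
import Data.Integer.Properties as ℤ
open import Data.List.Base using (List; []; _∷_; map; length; lookup)
open import Data.List.Extrema.Nat using (max; xs≤max)
open import Data.List.Membership.DecPropositional ℤ._≟_ using (_∈_; _∉_; _∈?_)
open import Data.List.Membership.Propositional.Properties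
  using (∈-map⁺; ∈-map⁻; ∈-concatMap⁺; ∈-concatMap⁻; ∈-++⁺ˡ; ∈-++⁺ʳ; ∈-++⁻)
open import Data.List.Membership.Propositional using (find; lose)
import Data.List.Relation.Unary.All as All
open import Data.List.Relation.Unary.Any using (here; index)
open import Data.List.Relation.Unary.Any.Properties using (lookup-index)
open import Data.Nat.Base as ℕ using (ℕ; zero; suc; _+_; _∸_; _^_; z≤n; s≤s; z<s; s<s)
import Data.Nat.Properties as ℕ
open import Data.Product.Base using (∃; ∃₂; _×_; _,_; map₁)
open import Data.Sum.Base as Sum using (_⊎_; inj₁; inj₂)
open import Function.Base using (_∘_; const)
open import Function.Definitions using (Injective)
open import Function.Bundles using (_⇔_; mk⇔; Equivalence; _↣_; Injection)
open import Function.Construct.Composition using (_⇔-∘_)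
open import Function.Construct.Symmetry using (⇔-sym)
open import Function.Properties.Inverse using (↔-sym; ↔⇒↣)
open import Relation.Binary.Definitions using (tri<; tri≈; tri>)
open import Relation.Binary.PropositionalEquality
  using (_≡_; _≗_; _≢_; refl; sym; trans; cong; subst; module ≡-Reasoning)
open import Relation.Nullary using (¬_; Dec; yes; no; does; contradiction)
open import Relation.Nullary.Decidable using (map′; _×-dec_)
open import Relation.Unary using (Decidable)

∈-sumset⁺ : ∀ {X Y : List ℤ} {x y} → x ∈ X → y ∈ Y → x ℤ.+ y ∈ sumset X Y
∈-sumset⁺ x∈X y∈Y = ∈-concatMap⁺ _ (lose x∈X (∈-map⁺ _ y∈Y))

∈-sumset⁻ : ∀ {X Y : List ℤ} {z} → z ∈ sumset X Y →
            ∃₂ λ x y → x ∈ X × y ∈ Y × z ≡ x ℤ.+ y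
∈-sumset⁻ {X} z∈X+Y with x , x∈X , z∈x+Y ← find (∈-concatMap⁻ _ {xs = X} z∈X+Y)
  with y , y∈Y , z≡x+y ← ∈-map⁻ _ z∈x+Y
  = x , y , x∈X , y∈Y , z≡x+y

∈-diffSet⁻ : ∀ {S z} → z ∈ diffSet S → ∃ λ n → z ≡ + n
∈-diffSet⁻ {S} z∈D with s , s∈S , z∈Ds ← find (∈-concatMap⁻ _ {xs = S} z∈D)
  with u , u∈S , z∈keep ← find (∈-concatMap⁻ _ {xs = S} z∈Ds)
  with u ℤ.≤? s | z∈keep
... | yes u≤s | here refl = ℤ.∣ s - u ∣ , sym (ℤ.0≤i⇒+∣i∣≡i (ℤ.i≤j⇒0≤j-i u≤s))
... | no _    | ()

0∈diffSet : ∀ {S} → S ≢ [] → + 0 ∈ diffSet S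
0∈diffSet {[]}    S≢[] = contradiction refl S≢[]
0∈diffSet {s ∷ _} _    with s ℤ.≤? s
... | yes _   = here (sym (ℤ.+-inverseʳ s))
... | no s≰s = contradiction ℤ.≤-refl s≰s

module _ (L : List ℤ) where

  search-skips : ∀ n fuel {k} → n ℕ.≤ k → k ℕ.< search n fuel L → + k ∈ L
  search-skips n zero       n≤k k<n = contradiction n≤k (ℕ.<⇒≱ k<n)
  search-skips n (suc fuel) n≤k k<s with + n ∈? L
  ... | no _    = contradiction n≤k (ℕ.<⇒≱ k<s)
  ... | yes n∈L with ℕ.m≤n⇒m<n∨m≡n n≤k
  ...   | inj₁ n<k  = search-skips (suc n) fuel n<k k<s
  ...   | inj₂ refl = n∈L

  search-stops : ∀ n fuel → + search n fuel L ∉ L ⊎ search n fuel L ≡ n + fuel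
  search-stops n zero       = inj₂ (sym (ℕ.+-identityʳ n))
  search-stops n (suc fuel) with + n ∈? L
  ... | no n∉L = inj₁ n∉L
  ... | yes _  = Sum.map₂ (λ eq → trans eq (sym (ℕ.+-suc n fuel))) (search-stops (suc n) fuel)

  ¬≤length⇒∈ : ¬ (∀ k → k ℕ.≤ length L → + k ∈ L)
  ¬≤length⇒∈ all∈ = <⇒notInjective (ℕ.n<1+n (length L)) position-injective
    where
    position : Fin (suc (length L)) → Fin (length L)
    position k = index (all∈ (toℕ k) (toℕ≤pred[n] k))
    position-injective : Injective _≡_ _≡_ position
    position-injective {i} {j} same = toℕ-injective (ℤ.+-injective (begin
      + toℕ i               ≡⟨ lookup-index (all∈ (toℕ i) (toℕ≤pred[n] i)) ⟩
      lookup L (position i) ≡⟨ cong (lookup L) same ⟩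
      lookup L (position j) ≡⟨ lookup-index (all∈ (toℕ j) (toℕ≤pred[n] j)) ⟨
      + toℕ j               ∎))
      where open ≡-Reasoning

  leastAbsent-∉ : + leastAbsent L ∉ L
  leastAbsent-∉ with search-stops 0 (suc (length L))
  ... | inj₁ ∉L = ∉L
  ... | inj₂ eq = contradiction (λ k k≤len → search-skips 0 _ z≤n (subst (k ℕ.<_) (sym eq) (s≤s k≤len)))
                                ¬≤length⇒∈

  <leastAbsent⇒∈ : ∀ {k} → k ℕ.< leastAbsent L → + k ∈ L
  <leastAbsent⇒∈ = search-skips 0 _ z≤n

does-≡⇒⇔ : ∀ {A B : Set} (A? : Dec A) (B? : Dec B) → does A? ≡ does B? → A ⇔ B
does-≡⇒⇔ (yes a) (yes b) _  = mk⇔ (const b) (const a)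
does-≡⇒⇔ (no ¬a) (no ¬b) _  = mk⇔ (⊥-elim ∘ ¬a) (⊥-elim ∘ ¬b)
does-≡⇒⇔ (yes _) (no _)  ()
does-≡⇒⇔ (no _)  (yes _) ()

ℕ→FinFunctions-repeat : ∀ {m n} (f : ℕ → Fin m → Fin n) → ∃₂ λ a b → a ℕ.< b × f a ≗ f b
ℕ→FinFunctions-repeat {m} {n} f
  with i , j , i<j , same ← pigeonhole (ℕ.n<1+n (n ^ m)) (funToFin ∘ f ∘ toℕ)
  = toℕ i , toℕ j , i<j , λ k → begin
    f (toℕ i) k                       ≡⟨ finToFun-funToFin (f (toℕ i)) k ⟨
    finToFun (funToFin (f (toℕ i))) k ≡⟨ cong (λ c → finToFun c k) same ⟩
    finToFun (funToFin (f (toℕ j))) k ≡⟨ finToFun-funToFin (f (toℕ j)) k ⟩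
    f (toℕ j) k                       ∎
  where open ≡-Reasoning

decidableRows-repeat : ∀ {Q : ℕ → ℕ → Set} → (∀ x j → Dec (Q x j)) → ∀ M →
                       ∃₂ λ a b → a ℕ.< b × ∀ j → j ℕ.< M → Q a j ⇔ Q b j
decidableRows-repeat {Q} Q? M =
  let a , b , a<b , same = ℕ→FinFunctions-repeat row
  in  a , b , a<b , λ j j<M → subst (λ i → Q a i ⇔ Q b i) (toℕ-fromℕ< j<M) (agree same (fromℕ< j<M))
  where
  Bool↣Fin2 : Bool ↣ Fin 2
  Bool↣Fin2 = ↔⇒↣ (↔-sym 2↔Bool)
  row : ℕ → Fin M → Fin 2
  row x j = Injection.to Bool↣Fin2 (does (Q? x (toℕ j)))
  agree : ∀ {a b} → row a ≗ row b → ∀ j → Q a (toℕ j) ⇔ Q b (toℕ j)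
  agree {a} {b} same j =
    does-≡⇒⇔ (Q? a (toℕ j)) (Q? b (toℕ j)) (Injection.injective Bool↣Fin2 (same j))

-- The guard j < x makes the positions left of 0 count as false despite truncated subtraction.
Window : (ℕ → Set) → ℕ → ℕ → Set
Window P x j = j ℕ.< x × P (x ∸ suc j)

Window-suc : ∀ {P x j} → Window P (suc x) (suc j) ⇔ Window P x j
Window-suc = mk⇔ (map₁ ℕ.s<s⁻¹) (map₁ s<s)

module _ (P : ℕ → Set) (M : ℕ) where

  SameWindow : ℕ → ℕ → Set
  SameWindow x y = ∀ j → j ℕ.< M → Window P x j ⇔ Window P y j

  SameWindow-sym : ∀ {x y} → SameWindow x y → SameWindow y x
  SameWindow-sym x≈y j j<M = ⇔-sym (x≈y j j<M)

  SameWindow-suc : ∀ {x y} → (P x ⇔ P y) → SameWindow x y → SameWindow (suc x) (suc y)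
  SameWindow-suc Px⇔Py _   zero    _    = mk⇔ (λ (_ , px) → z<s , Equivalence.to Px⇔Py px)
                                              (λ (_ , py) → z<s , Equivalence.from Px⇔Py py)
  SameWindow-suc _     x≈y (suc j) sj<M =
    ⇔-sym (Window-suc {P}) ⇔-∘ (x≈y j (ℕ.<⇒≤ sj<M) ⇔-∘ Window-suc {P})

  SameWindow-repeats : Decidable P → ∃₂ λ a b → a ℕ.< b × SameWindow a b
  SameWindow-repeats P? = decidableRows-repeat (λ x j → j ℕ.<? x ×-dec P? (x ∸ suc j)) M

  module _ (determined : ∀ {x y} → SameWindow x y → P x → P y) where

    determined-⇔ : ∀ {x y} → SameWindow x y → P x ⇔ P y
    determined-⇔ x≈y = mk⇔ (determined x≈y) (determined (SameWindow-sym x≈y))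

    SameWindow-+ : ∀ {x y} → SameWindow x y → ∀ k → SameWindow (x + k) (y + k)
    SameWindow-+ {x} {y} x≈y zero    rewrite ℕ.+-identityʳ x | ℕ.+-identityʳ y = x≈y
    SameWindow-+ {x} {y} x≈y (suc k) rewrite ℕ.+-suc x k | ℕ.+-suc y k =
      let x+k≈y+k = SameWindow-+ x≈y k in SameWindow-suc (determined-⇔ x+k≈y+k) x+k≈y+k

    eventuallyPeriodic : Decidable P → ∃₂ λ a b → a ℕ.< b × ∀ k → P (a + k) ⇔ P (b + k)
    eventuallyPeriodic P? with a , b , a<b , a≈b ← SameWindow-repeats P?
      = a , b , a<b , λ k → determined-⇔ (SameWindow-+ a≈b k)

module Greedy (S : List ℤ) (S≢[] : S ≢ []) where

  D : List ℤ
  D = diffSet S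

  Forbidden : ℕ → List ℤ
  Forbidden i = sumset (Aprev S i) D

  t∈Aprev : ∀ {i j} → j ℕ.< i → + t S j ∈ Aprev S i
  t∈Aprev {suc i} j<1+i with ℕ.m<1+n⇒m<n∨m≡n j<1+i
  ... | inj₁ j<i  = ∈-++⁺ˡ (t∈Aprev j<i)
  ... | inj₂ refl = ∈-++⁺ʳ (Aprev S i) (here refl)

  ∈Aprev⇒t : ∀ i {z} → z ∈ Aprev S i → ∃ λ j → j ℕ.< i × z ≡ + t S j
  ∈Aprev⇒t (suc i) z∈A with ∈-++⁻ (Aprev S i) z∈A
  ... | inj₁ z∈Aprev = let j , j<i , z≡tj = ∈Aprev⇒t i z∈Aprev in j , ℕ.m<n⇒m<1+n j<i , z≡tj
  ... | inj₂ (here z≡ti) = i , ℕ.n<1+n i , z≡ti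

  Forbidden-suc : ∀ i {z} → z ∈ Forbidden i → z ∈ Forbidden (suc i)
  Forbidden-suc i z∈F with x , y , x∈A , y∈D , refl ← ∈-sumset⁻ {Aprev S i} z∈F
    = ∈-sumset⁺ {Aprev S (suc i)} (∈-++⁺ˡ x∈A) y∈D

  ≤t⇒∈Forbidden-suc : ∀ i {k} → k ℕ.≤ t S i → + k ∈ Forbidden (suc i)
  ≤t⇒∈Forbidden-suc i k≤ti with ℕ.m≤n⇒m<n∨m≡n k≤ti
  ... | inj₁ k<ti = Forbidden-suc i (<leastAbsent⇒∈ (Forbidden i) k<ti)
  ... | inj₂ refl = subst (_∈ Forbidden (suc i)) (ℤ.+-identityʳ _)
                      (∈-sumset⁺ {Aprev S (suc i)} (t∈Aprev (ℕ.n<1+n i)) (0∈diffSet S≢[]))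

  t<t-suc : ∀ i → t S i ℕ.< t S (suc i)
  t<t-suc i = ℕ.≰⇒> (leastAbsent-∉ (Forbidden (suc i)) ∘ ≤t⇒∈Forbidden-suc i)

  t-strictlyIncreasing : ∀ {i j} → j ℕ.< i → t S j ℕ.< t S i
  t-strictlyIncreasing {suc i} j<1+i with ℕ.m<1+n⇒m<n∨m≡n j<1+i
  ... | inj₁ j<i  = ℕ.<-trans (t-strictlyIncreasing j<i) (t<t-suc i)
  ... | inj₂ refl = t<t-suc i

  t-cancel-< : ∀ {i j} → t S j ℕ.< t S i → j ℕ.< i
  t-cancel-< {i} {j} tj<ti with ℕ.<-cmp j i
  ... | tri< j<i _ _  = j<i
  ... | tri≈ _ refl _ = contradiction tj<ti (ℕ.<-irrefl refl)
  ... | tri> _ _ i<j  = contradiction tj<ti (ℕ.<-asym (t-strictlyIncreasing i<j))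

  i≤t : ∀ i → i ℕ.≤ t S i
  i≤t zero    = z≤n
  i≤t (suc i) = ℕ.≤-<-trans (i≤t i) (t<t-suc i)

  IsTerm : ℕ → Set
  IsTerm n = ∃ λ i → t S i ≡ n

  ∈A⇒IsTerm : ∀ i {n} → + n ∈ A S i → IsTerm n
  ∈A⇒IsTerm i n∈A = let j , _ , +n≡+tj = ∈Aprev⇒t (suc i) n∈A in j , sym (ℤ.+-injective +n≡+tj)

  IsTerm? : Decidable IsTerm
  IsTerm? n = map′ (∈A⇒IsTerm n) (λ { (i , refl) → t∈Aprev (s≤s (i≤t i)) }) (+ n ∈? A S n)

  A∞⇔IsTerm : ∀ {n} → A∞ S (+ n) ⇔ IsTerm n
  A∞⇔IsTerm = mk⇔ (λ (i , n∈A) → ∈A⇒IsTerm i n∈A) (λ { (i , refl) → i , t∈Aprev (ℕ.n<1+n i) })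

  Blocked : ℕ → Set
  Blocked n = ∃ λ d → + suc d ∈ D × Window IsTerm n d

  IsTerm⇒¬Blocked : ∀ {n} → IsTerm n → ¬ Blocked n
  IsTerm⇒¬Blocked (i , refl) (d , d∈D , d<ti , j , tj≡ti∸d) =
    leastAbsent-∉ (Forbidden i)
      (subst (_∈ Forbidden i) (cong +_ tj+d≡ti) (∈-sumset⁺ {Aprev S i} (t∈Aprev j<i) d∈D))
    where
    open ≡-Reasoning
    tj+d≡ti : t S j + suc d ≡ t S i
    tj+d≡ti = begin
      t S j + suc d         ≡⟨ cong (_+ suc d) tj≡ti∸d ⟩
      t S i ∸ suc d + suc d ≡⟨ ℕ.m∸n+n≡m d<ti ⟩
      t S i                 ∎
    j<i : j ℕ.< i
    j<i = t-cancel-< (subst (t S j ℕ.<_) tj+d≡ti (ℕ.m<m+n (t S j) z<s))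

  ∈Forbidden⇒ : ∀ i {n} → + n ∈ Forbidden i → ∃₂ λ j e → + e ∈ D × n ≡ t S j + e
  ∈Forbidden⇒ i n∈F with u , y , u∈A , y∈D , +n≡u+y ← ∈-sumset⁻ {Aprev S i} n∈F
    with j , _ , refl ← ∈Aprev⇒t i u∈A
    with e , refl ← ∈-diffSet⁻ {S} y∈D
    = j , e , y∈D , ℤ.+-injective +n≡u+y

  ¬Blocked⇒IsTerm : ∀ {n} → ¬ Blocked n → IsTerm n
  ¬Blocked⇒IsTerm {n} unblocked
    with ∈Forbidden⇒ (suc n) (<leastAbsent⇒∈ (Forbidden (suc n)) (i≤t (suc n)))
  ... | j , zero  , _   , refl = j , sym (ℕ.+-identityʳ (t S j))
  ... | j , suc d , d∈D , refl =
    contradiction (d , d∈D , ℕ.m≤n+m (suc d) (t S j) , j , sym (ℕ.m+n∸n≡m (t S j) (suc d))) unblocked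

  maxDiff : ℕ
  maxDiff = max 0 (map ℤ.∣_∣ D)

  positiveDiff< : ∀ {d} → + suc d ∈ D → d ℕ.< maxDiff
  positiveDiff< d∈D = All.lookup (xs≤max 0 (map ℤ.∣_∣ D)) (∈-map⁺ ℤ.∣_∣ d∈D)

  IsTerm-determined : ∀ {x y} → SameWindow IsTerm maxDiff x y → IsTerm x → IsTerm y
  IsTerm-determined x≈y x-term = ¬Blocked⇒IsTerm λ (d , d∈D , y-window) →
    IsTerm⇒¬Blocked x-term (d , d∈D , Equivalence.from (x≈y d (positiveDiff< d∈D)) y-window)

  A∞-eventuallyPeriodic : ∃₂ λ a b → a ℕ.< b × ∀ k → A∞ S (+ (a + k)) ⇔ A∞ S (+ (b + k))
  A∞-eventuallyPeriodic =
    let a , b , a<b , periodic = eventuallyPeriodic IsTerm maxDiff IsTerm-determined IsTerm?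
    in  a , b , a<b , λ k → ⇔-sym A∞⇔IsTerm ⇔-∘ (periodic k ⇔-∘ A∞⇔IsTerm)

[m+k]+[n-m]≡n+k : ∀ {m n} k → m ℕ.≤ n → + (m + k) ℤ.+ (+ n - + m) ≡ + (n + k)
[m+k]+[n-m]≡n+k {m} {n} k m≤n = begin
  + (m + k) ℤ.+ (+ n - + m)  ≡⟨ cong (ℤ._+_ (+ (m + k))) (trans (ℤ.[+m]-[+n]≡m⊖n n m) (ℤ.⊖-≥ m≤n)) ⟩
  + (m + k + (n ∸ m))        ≡⟨ cong +_ (ℕ.+-comm (m + k) (n ∸ m)) ⟩
  + (n ∸ m + (m + k))        ≡⟨ cong +_ (ℕ.+-assoc (n ∸ m) m k) ⟨
  + (n ∸ m + m + k)          ≡⟨ cong (λ x → + (x + k)) (ℕ.m∸n+n≡m m≤n) ⟩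
  + (n + k)                  ∎
  where open ≡-Reasoning

lemma3p2 : (S : List ℤ) → S ≢ [] →
    ∃₂ λ (a b : ℤ) → (+ 0 ≤ a) × (a < b) × ForwardPeriodic (A∞ S) a (b - a)
lemma3p2 S S≢[] =
  let a , b , a<b , periodic = Greedy.A∞-eventuallyPeriodic S S≢[]
  in  + a , + b , +≤+ z≤n , +<+ a<b , λ k →
        subst (λ z → A∞ S (+ (a + k)) ⇔ A∞ S z) (sym ([m+k]+[n-m]≡n+k k (ℕ.<⇒≤ a<b))) (periodic k)
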